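{- For any partition $\lambda$ of $n$ and any $d\le n$, $\sum_{w\in CYW_{\lambda,d}}w\in(I^{\mathrm{kron}})^\perp$.
   Context: $\mathcal{A}=\{1,\dots,N\}\sqcup\{\bar1,\dots,\bar N\}$ (unbarred/barred letters); colored words are finite words in $\mathcal{A}$. Natural order $<$: $1<\bar1<2<\bar2<\cdots<N<\bar N$. $\mathcal{U}$: free associative $\mathbb{Z}$-algebra on noncommuting $u_x$ ($x\in\mathcal{A}$), monomials identified with colored words; $\langle\cdot,\cdot\rangle$ makes colored words orthonormal; $(I)^\perp=\{\gamma\in\mathcal{U}:\langle f,\gamma\rangle=0\ \forall f\in I\}$. $a{\Downarrow}=\overline{a-1}$ ($2\le a\le N$), $\bar a{\Downarrow}=a$. $I^{\mathrm{kron}}$ is the two-sided ideal generated by: $yyx-yxy$ ($x\in\mathcal{A}$, $y$ unbarred, $x<y$); $zyy-yzy$ ($y$ unbarred, $y<z$); $yyz-yzy$ ($y$ barred, $y<z$); $xyy-yxy$ ($y$ barred, $x<y$); $(xz-zx)y-y(xz-zx)$ for $x=y{\Downarrow}=z{\Downarrow}{\Downarrow}$; $xz-zx$ for $z{\Downarrow}{\Downarrow}$ defined and $x<z{\Downarrow}{\Downarrow}$. For a colored word $w$, $w^r$ is the ordinary word obtained by moving barred letters to the right end (keeping the order of the unbarred ones), reversing the barred subword and removing bars. An ordinary word is Yamanouchi of content $\lambda$ if it has $\lambda_i$ letters $i$ and every suffix has at least as many $i$'s as $(i+1)$'s. $CYW_{\lambda,d}$ is the set of colored words with exactly $d$ barred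 letters whose $w^r$ is Yamanouchi of content $\lambda$. -}

module Defs where

open import Data.Nat as ℕ using (ℕ; zero; suc; _≤_; _≥_)
open import Data.Integer as ℤ using (ℤ; +_; -_)
open import Data.Fin as Fin using (Fin; toℕ)
open import Data.Bool using (Bool; true; false; if_then_else_)
open import Data.List using (List; []; _∷_; _++_; map; reverse; filter; length; drop; foldr; concatMap)
open import Data.List.Relation.Unary.All using (All)
open import Data.List.Relation.Unary.Linked using (Linked)
open import Data.Product using (_×_; _,_; Σ; ∃; ∃-syntax)
open import Data.Sum using (_⊎_)
open import Data.Nat.ListAction using (sum)
open import Relation.Binary.PropositionalEquality using (_≡_)
open import Relation.Nullary using (Dec; yes; no)
import Data.List.Properties as LP
import Data.Product.Properties as PP
import Data.Bool.Properties as BP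

-- Colored alphabet A = {1..N} ⊔ {1̄..N̄}.
-- A letter is (i , b) with i : Fin N representing the number toℕ i + 1,
-- and b = true iff the letter is barred.

Letter : ℕ → Set
Letter N = Fin N × Bool

IsUnbarred IsBarred : ∀ {N} → Letter N → Set
IsUnbarred (_ , b) = b ≡ false
IsBarred   (_ , b) = b ≡ true

_<ᴸ_ : ∀ {N} → Letter N → Letter N → Set
(i , b) <ᴸ (j , c) = (toℕ i ℕ.< toℕ j) ⊎ ((i ≡ j) × (b ≡ false) × (c ≡ true))

-- Down y x  means  y⇓ = x  (y⇓ defined):
--   ā⇓ = a ;  a⇓ = \overline{a-1} for 2 ≤ a ≤ N.
Down : ∀ {N} → Letter N → Letter N → Set
Down (j , c) (i , b) =
  ((c ≡ true) × (b ≡ false) × (i ≡ j))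
  ⊎ ((c ≡ false) × (b ≡ true) × (suc (toℕ i) ≡ toℕ j))

Word : ℕ → Set
Word N = List (Letter N)

_≟ᵂ_ : ∀ {N} (u v : Word N) → Dec (u ≡ v)
_≟ᵂ_ = LP.≡-dec (PP.≡-dec Fin._≟_ BP._≟_)

-- The free associative ℤ-algebra U, elements represented as formal
-- finite ℤ-linear combinations of colored words (lists of terms).

U : ℕ → Set
U N = List (ℤ × Word N)

⟦_⟧ : ∀ {N} → Word N → U N
⟦ w ⟧ = (+ 1 , w) ∷ []

_⊕_ : ∀ {N} → U N → U N → U N
f ⊕ g = f ++ g

⊖_ : ∀ {N} → U N → U N
⊖ f = map (λ { (c , w) → (- c , w) }) f

_⊝_ : ∀ {N} → U N → U N → U N
f ⊝ g = f ⊕ (⊖ g)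

_⊛_ : ∀ {N} → U N → U N → U N
f ⊛ g = concatMap (λ { (c , u) → map (λ { (d , v) → (c ℤ.* d , u ++ v) }) g }) f

δ : ∀ {N} → Word N → Word N → ℤ
δ u v with u ≟ᵂ v
... | yes _ = + 1
... | no  _ = + 0

coeff : ∀ {N} → U N → Word N → ℤ
coeff f w = foldr (λ { (c , u) acc → c ℤ.* δ u w ℤ.+ acc }) (+ 0) f

⟨_,_⟩ : ∀ {N} → U N → U N → ℤ
⟨ f , g ⟩ = foldr (λ { (c , u) acc → c ℤ.* coeff g u ℤ.+ acc }) (+ 0) f

data KronGen {N : ℕ} : U N → Set where
  g1 : ∀ x y → IsUnbarred y → x <ᴸ y →
       KronGen (⟦ y ∷ y ∷ x ∷ [] ⟧ ⊝ ⟦ y ∷ x ∷ y ∷ [] ⟧)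
  g2 : ∀ y z → IsUnbarred y → y <ᴸ z →
       KronGen (⟦ z ∷ y ∷ y ∷ [] ⟧ ⊝ ⟦ y ∷ z ∷ y ∷ [] ⟧)
  g3 : ∀ y z → IsBarred y → y <ᴸ z →
       KronGen (⟦ y ∷ y ∷ z ∷ [] ⟧ ⊝ ⟦ y ∷ z ∷ y ∷ [] ⟧)
  g4 : ∀ x y → IsBarred y → x <ᴸ y →
       KronGen (⟦ x ∷ y ∷ y ∷ [] ⟧ ⊝ ⟦ y ∷ x ∷ y ∷ [] ⟧)
  g5 : ∀ x y z → Down y x → (∃[ w ] (Down z w × Down w x)) →
       KronGen (((⟦ x ∷ z ∷ [] ⟧ ⊝ ⟦ z ∷ x ∷ [] ⟧) ⊛ ⟦ y ∷ [] ⟧)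
                ⊝ (⟦ y ∷ [] ⟧ ⊛ (⟦ x ∷ z ∷ [] ⟧ ⊝ ⟦ z ∷ x ∷ [] ⟧)))
  g6 : ∀ x z → (∃[ w ] ∃[ v ] (Down z w × Down w v × x <ᴸ v)) →
       KronGen (⟦ x ∷ z ∷ [] ⟧ ⊝ ⟦ z ∷ x ∷ [] ⟧)

-- The two-sided ideal generated by KronGen (as a set of elements of U;
-- closed under change of representative via `resp`).
data InIkron {N : ℕ} : U N → Set where
  gen  : ∀ {f} → KronGen f → InIkron f
  nil  : InIkron []
  add  : ∀ {f g} → InIkron f → InIkron g → InIkron (f ⊕ g)
  mulˡ : ∀ {f} (a : U N) → InIkron f → InIkron (a ⊛ f)
  mulʳ : ∀ {f} → InIkron f → (a : U N) → InIkron (f ⊛ a)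
  resp : ∀ {f g} → (∀ w → coeff f w ≡ coeff g w) → InIkron f → InIkron g

InIkronPerp : ∀ {N} → U N → Set
InIkronPerp {N} γ = ∀ (f : U N) → InIkron f → ⟨ f , γ ⟩ ≡ + 0

IsPartitionOf : List ℕ → ℕ → Set
IsPartitionOf λ' n = All (λ p → 1 ≤ p) λ' × Linked _≥_ λ' × sum λ' ≡ n

-- λ_i (1-indexed; 0 beyond the length)
part : List ℕ → ℕ → ℕ
part []       _       = 0
part (p ∷ _)  1       = p
part (_ ∷ ps) (suc (suc i)) = part ps (suc i)
part (_ ∷ _)  0       = 0

count : ℕ → List ℕ → ℕ
count i []       = 0
count i (j ∷ js) with i ℕ.≟ j
... | yes _ = suc (count i js)
... | no  _ = count i js

Yamanouchi : List ℕ → List ℕ → Set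
Yamanouchi λ' v =
  (∀ i → 1 ≤ i → count i v ≡ part λ' i) ×
  (∀ k i → 1 ≤ i → count (suc i) (drop k v) ≤ count i (drop k v))

val : ∀ {N} → Letter N → ℕ
val (i , _) = suc (toℕ i)

isBarredᵇ : ∀ {N} → Letter N → Bool
isBarredᵇ (_ , b) = b

isUnbarredᵇ : ∀ {N} → Letter N → Bool
isUnbarredᵇ (_ , b) = if b then false else true

_ʳ : ∀ {N} → Word N → List ℕ
w ʳ = map val (filter (λ x → BP.T? (isUnbarredᵇ x)) w)
      ++ reverse (map val (filter (λ x → BP.T? (isBarredᵇ x)) w))

numBarred : ∀ {N} → Word N → ℕ
numBarred w = length (filter (λ x → BP.T? (isBarredᵇ x)) w)

CYW : ∀ {N} → List ℕ → ℕ → Word N → Set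
CYW λ' d w = (numBarred w ≡ d) × Yamanouchi λ' (w ʳ)

module Submission where

-- A functional on words is orthogonal to a two-sided ideal iff it kills u g v for
-- every generator g and all words u, v.  For the indicator of CYW_{λ,d} every
-- generator of I^kron is a difference A − B (or, for the fifth family, a sum of two
-- such differences) of words that are interchangeable as factors: u A v ∈ CYW iff
-- u B v ∈ CYW.  Since w^r is the unbarred subword followed by the reversed barred
-- subword, the unbarred (resp. barred) letters of a factor form a factor (resp. a
-- reversed factor) of w^r.  Interchangeability thus reduces to either equal parts or
-- one of the local moves bba ↔ bab, baa ↔ aba (a < b) and ab ↔ ba (|a − b| ≥ 2) on
-- ordinary words, and each of these preserves the Yamanouchi property.

open import Defs
open import Data.Nat as ℕ using (ℕ; suc; _+_; _≤_; _<_; z≤n; s≤s; s≤s⁻¹)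
open import Data.Nat.Properties
  using (≤-refl; ≤-reflexive; ≤-trans; n≤1+n; +-assoc; +-comm; <⇒≢; >⇒≢; m<n⇒m<1+n; 1+n≢n)
open import Data.Integer as ℤ using (ℤ; +_)
import Data.Integer.Properties as ℤ
open import Data.Integer.Tactic.RingSolver using (solve-∀)
open import Data.Bool using (true; false; not)
open import Data.Bool.Properties using (T?; not-involutive)
open import Data.Fin using (toℕ)
open import Data.List using (List; []; _∷_; _++_; map; filter; reverse; length; drop; deduplicate)
open import Data.List.Properties
  using (++-assoc; ++-identityʳ; filter-++; map-++; reverse-++; length-map)
open import Data.List.Membership.Propositional using (_∈_; _∉_)
open import Data.List.Membership.Propositional.Properties
  using (∈-map⁺; ∈-deduplicate⁺; ∈-++⁺ˡ; ∈-++⁺ʳ)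
open import Data.List.Relation.Unary.Any using (here; there)
import Data.List.Relation.Unary.All as All
open import Data.List.Relation.Unary.Unique.Propositional using (Unique; _∷_)
open import Data.List.Relation.Unary.Unique.DecPropositional.Properties using (deduplicate-!)
open import Data.List.Relation.Binary.Permutation.Propositional
  using (_↭_; refl; prep; swap; trans; ↭-sym; ↭-trans; ↭-reflexive)
open import Data.List.Relation.Binary.Permutation.Propositional.Properties
  using (↭-length; ++⁺ˡ; ++⁺ʳ; ↭-reverse)
open import Data.Product using (_×_; _,_; proj₁; proj₂; ∃-syntax)
open import Data.Sum using (inj₁; inj₂)
open import Data.Unit using (⊤)
open import Data.Empty using (⊥-elim)
open import Function.Base using (case_of_)
open import Function.Bundles using (_⇔_; Equivalence)
open import Relation.Nullary using (yes; no)
open import Relation.Binary.PropositionalEquality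
  using (_≡_; _≢_; refl; sym; cong; cong₂; subst; subst₂; ≢-sym; module ≡-Reasoning)
import Relation.Binary.PropositionalEquality as ≡
import Data.List.Membership.DecPropositional as DecMembership

open ≡-Reasoning

-- Linear functionals on U

module _ {N : ℕ} where

  lin : (Word N → ℤ) → U N → ℤ
  lin φ []            = + 0
  lin φ ((c , w) ∷ f) = c ℤ.* φ w ℤ.+ lin φ f

  lin-cong-∈ : ∀ {φ ψ} (f : U N) → (∀ {c w} → (c , w) ∈ f → φ w ≡ ψ w) → lin φ f ≡ lin ψ f
  lin-cong-∈ []            eq = refl
  lin-cong-∈ ((c , w) ∷ f) eq =
    cong₂ (λ a b → c ℤ.* a ℤ.+ b) (eq (here refl)) (lin-cong-∈ f (λ p → eq (there p)))

  lin-cong : ∀ {φ ψ} (f : U N) → (∀ w → φ w ≡ ψ w) → lin φ f ≡ lin ψ f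
  lin-cong f eq = lin-cong-∈ f (λ {_} {w} _ → eq w)

  lin-zero : ∀ {φ} (f : U N) → (∀ w → φ w ≡ + 0) → lin φ f ≡ + 0
  lin-zero []            eq = refl
  lin-zero ((c , w) ∷ f) eq rewrite eq w | lin-zero f eq | ℤ.*-zeroʳ c = refl

  lin-++ : ∀ φ (f g : U N) → lin φ (f ++ g) ≡ lin φ f ℤ.+ lin φ g
  lin-++ φ []            g = sym (ℤ.+-identityˡ _)
  lin-++ φ ((c , w) ∷ f) g rewrite lin-++ φ f g = sym (ℤ.+-assoc (c ℤ.* φ w) _ _)

  lin-+ : ∀ φ ψ (f : U N) → lin (λ w → φ w ℤ.+ ψ w) f ≡ lin φ f ℤ.+ lin ψ f
  lin-+ φ ψ []            = refl
  lin-+ φ ψ ((c , w) ∷ f) rewrite lin-+ φ ψ f = shuffle c (φ w) (ψ w) (lin φ f) (lin ψ f)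
    where
    shuffle : ∀ c a b x y → c ℤ.* (a ℤ.+ b) ℤ.+ (x ℤ.+ y) ≡ (c ℤ.* a ℤ.+ x) ℤ.+ (c ℤ.* b ℤ.+ y)
    shuffle = solve-∀

  lin-*ˡ : ∀ φ c (f : U N) → lin (λ w → c ℤ.* φ w) f ≡ c ℤ.* lin φ f
  lin-*ˡ φ c []            = sym (ℤ.*-zeroʳ c)
  lin-*ˡ φ c ((d , w) ∷ f) rewrite lin-*ˡ φ c f = shuffle c d (φ w) (lin φ f)
    where
    shuffle : ∀ c d a x → d ℤ.* (c ℤ.* a) ℤ.+ c ℤ.* x ≡ c ℤ.* (d ℤ.* a ℤ.+ x)
    shuffle = solve-∀

  lin-*ʳ : ∀ φ c (f : U N) → lin (λ w → φ w ℤ.* c) f ≡ lin φ f ℤ.* c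
  lin-*ʳ φ c f = begin
    lin (λ w → φ w ℤ.* c) f  ≡⟨ lin-cong f (λ w → ℤ.*-comm (φ w) c) ⟩
    lin (λ w → c ℤ.* φ w) f  ≡⟨ lin-*ˡ φ c f ⟩
    c ℤ.* lin φ f            ≡⟨ ℤ.*-comm c _ ⟩
    lin φ f ℤ.* c            ∎

  lin-swap : ∀ (Φ : Word N → Word N → ℤ) (f g : U N) →
    lin (λ s → lin (Φ s) g) f ≡ lin (λ t → lin (λ s → Φ s t) f) g
  lin-swap Φ []            g = sym (lin-zero g (λ _ → refl))
  lin-swap Φ ((c , s) ∷ f) g = begin
    c ℤ.* lin (Φ s) g ℤ.+ lin (λ s → lin (Φ s) g) f
      ≡⟨ cong₂ ℤ._+_ (sym (lin-*ˡ (Φ s) c g)) (lin-swap Φ f g) ⟩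
    lin (λ t → c ℤ.* Φ s t) g ℤ.+ lin (λ t → lin (λ s → Φ s t) f) g
      ≡⟨ sym (lin-+ _ _ g) ⟩
    lin (λ t → c ℤ.* Φ s t ℤ.+ lin (λ s → Φ s t) f) g ∎

  lin-⊛ : ∀ φ (f g : U N) → lin φ (f ⊛ g) ≡ lin (λ s → lin (λ t → φ (s ++ t)) g) f
  lin-⊛ φ []            g = refl
  lin-⊛ φ ((c , s) ∷ f) g = begin
    lin φ (left ++ f ⊛ g)                  ≡⟨ lin-++ φ left (f ⊛ g) ⟩
    lin φ left ℤ.+ lin φ (f ⊛ g)           ≡⟨ cong₂ ℤ._+_ (lin-left g) (lin-⊛ φ f g) ⟩
    c ℤ.* lin (λ t → φ (s ++ t)) g ℤ.+ _   ∎
    where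
    left = map (λ { (d , t) → (c ℤ.* d , s ++ t) }) g
    lin-left : ∀ g → lin φ (map (λ { (d , t) → (c ℤ.* d , s ++ t) }) g) ≡
                     c ℤ.* lin (λ t → φ (s ++ t)) g
    lin-left []            = sym (ℤ.*-zeroʳ c)
    lin-left ((d , t) ∷ g) =
      ≡.trans (cong (ℤ._+_ (c ℤ.* d ℤ.* φ (s ++ t))) (lin-left g))
              (shuffle c d (φ (s ++ t)) (lin (λ t → φ (s ++ t)) g))
      where
      shuffle : ∀ c d a x → c ℤ.* d ℤ.* a ℤ.+ c ℤ.* x ≡ c ℤ.* (d ℤ.* a ℤ.+ x)
      shuffle = solve-∀

  ⟨,⟩-lin : ∀ (f γ : U N) → ⟨ f , γ ⟩ ≡ lin (coeff γ) f
  ⟨,⟩-lin []            γ = refl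
  ⟨,⟩-lin ((c , u) ∷ f) γ = cong (ℤ._+_ (c ℤ.* coeff γ u)) (⟨,⟩-lin f γ)

  lin-difference : ∀ φ (A B : Word N) → φ A ≡ φ B → lin φ (⟦ A ⟧ ⊝ ⟦ B ⟧) ≡ + 0
  lin-difference φ A B φA≡φB rewrite φA≡φB = cancel (φ B)
    where
    cancel : ∀ a → + 1 ℤ.* a ℤ.+ (ℤ.- + 1 ℤ.* a ℤ.+ + 0) ≡ + 0
    cancel = solve-∀

  lin-nested-commutator : ∀ φ (x y z : Letter N) →
    φ (x ∷ z ∷ y ∷ []) ≡ φ (y ∷ x ∷ z ∷ []) → φ (z ∷ x ∷ y ∷ []) ≡ φ (y ∷ z ∷ x ∷ []) →
    lin φ (((⟦ x ∷ z ∷ [] ⟧ ⊝ ⟦ z ∷ x ∷ [] ⟧) ⊛ ⟦ y ∷ [] ⟧) ⊝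
           (⟦ y ∷ [] ⟧ ⊛ (⟦ x ∷ z ∷ [] ⟧ ⊝ ⟦ z ∷ x ∷ [] ⟧))) ≡ + 0
  lin-nested-commutator φ x y z e₁ e₂ rewrite e₁ | e₂ =
    cancel (φ (y ∷ x ∷ z ∷ [])) (φ (y ∷ z ∷ x ∷ []))
    where
    cancel : ∀ a b →
      + 1 ℤ.* a ℤ.+ (ℤ.- + 1 ℤ.* b ℤ.+ (ℤ.- + 1 ℤ.* a ℤ.+ (+ 1 ℤ.* b ℤ.+ + 0))) ≡ + 0
    cancel = solve-∀

  δ-refl : ∀ (u : Word N) → δ u u ≡ + 1
  δ-refl u with u ≟ᵂ u
  ... | yes _   = refl
  ... | no  u≢u = ⊥-elim (u≢u refl)

  δ-≢ : ∀ {u v : Word N} → u ≢ v → δ u v ≡ + 0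
  δ-≢ {u} {v} u≢v with u ≟ᵂ v
  ... | yes u≡v = ⊥-elim (u≢v u≡v)
  ... | no  _   = refl

  δ-swap-* : ∀ (φ : Word N → ℤ) u w → δ u w ℤ.* φ w ≡ δ w u ℤ.* φ u
  δ-swap-* φ u w = case u ≟ᵂ w of λ where
    (yes refl) → refl
    (no  u≢w)  → ≡.trans (cong (ℤ._* φ w) (δ-≢ u≢w))
                         (cong (ℤ._* φ u) (sym (δ-≢ (≢-sym u≢w))))

  coeff-lin : ∀ (f : U N) w → coeff f w ≡ lin (λ u → δ u w) f
  coeff-lin []            w = refl
  coeff-lin ((c , u) ∷ f) w = cong (ℤ._+_ (c ℤ.* δ u w)) (coeff-lin f w)

  indicator : List (Word N) → U N
  indicator = map (λ w → (+ 1 , w))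

  coeff-indicator-∉ : ∀ {S w} → w ∉ S → coeff (indicator S) w ≡ + 0
  coeff-indicator-∉ {[]}    w∉S = refl
  coeff-indicator-∉ {s ∷ S} w∉S =
    cong₂ (λ a b → + 1 ℤ.* a ℤ.+ b) (δ-≢ (λ s≡w → w∉S (here (sym s≡w))))
                                   (coeff-indicator-∉ (λ w∈S → w∉S (there w∈S)))

  coeff-indicator-∈ : ∀ {S w} → Unique S → w ∈ S → coeff (indicator S) w ≡ + 1
  coeff-indicator-∈ {w ∷ S} (w∉S ∷ _) (here refl) =
    cong₂ (λ a b → + 1 ℤ.* a ℤ.+ b) (δ-refl w)
                                   (coeff-indicator-∉ (λ w∈S → All.lookup w∉S w∈S refl))
  coeff-indicator-∈ {s ∷ S} (s∉S ∷ S!) (there w∈S) =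
    cong₂ (λ a b → + 1 ℤ.* a ℤ.+ b) (δ-≢ (All.lookup s∉S w∈S)) (coeff-indicator-∈ S! w∈S)

  coeff-indicator-resp : ∀ {S} {P : Word N → Set} → Unique S → (∀ w → (w ∈ S) ⇔ P w) →
    ∀ {w₁ w₂} → (P w₁ → P w₂) → (P w₂ → P w₁) → coeff (indicator S) w₁ ≡ coeff (indicator S) w₂
  coeff-indicator-resp {S} S! S⇔P {w₁} {w₂} to from with w₁ ∈? S | w₂ ∈? S
    where
    open DecMembership (_≟ᵂ_ {N}) using (_∈?_)
  ... | yes w₁∈S | yes w₂∈S = ≡.trans (coeff-indicator-∈ S! w₁∈S) (sym (coeff-indicator-∈ S! w₂∈S))
  ... | no  w₁∉S | no  w₂∉S = ≡.trans (coeff-indicator-∉ w₁∉S) (sym (coeff-indicator-∉ w₂∉S))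
  ... | yes w₁∈S | no  w₂∉S = ⊥-elim (w₂∉S (Equivalence.from (S⇔P w₂) (to   (Equivalence.to (S⇔P w₁) w₁∈S))))
  ... | no  w₁∉S | yes w₂∈S = ⊥-elim (w₁∉S (Equivalence.from (S⇔P w₁) (from (Equivalence.to (S⇔P w₂) w₂∈S))))

  lin-indicator-δ : ∀ φ {D u} → Unique D → u ∈ D → lin (λ w → δ u w ℤ.* φ w) (indicator D) ≡ φ u
  lin-indicator-δ φ {D} {u} D! u∈D = begin
    lin (λ w → δ u w ℤ.* φ w) (indicator D)  ≡⟨ lin-cong (indicator D) (δ-swap-* φ u) ⟩
    lin (λ w → δ w u ℤ.* φ u) (indicator D)  ≡⟨ lin-*ʳ (λ w → δ w u) (φ u) (indicator D) ⟩
    lin (λ w → δ w u) (indicator D) ℤ.* φ u  ≡⟨ cong (ℤ._* φ u) (sym (coeff-lin (indicator D) u)) ⟩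
    coeff (indicator D) u ℤ.* φ u            ≡⟨ cong (ℤ._* φ u) (coeff-indicator-∈ D! u∈D) ⟩
    + 1 ℤ.* φ u                              ≡⟨ ℤ.*-identityˡ (φ u) ⟩
    φ u                                      ∎

  lin-via-coeff : ∀ φ (f : U N) {D} → Unique D → (∀ {c w} → (c , w) ∈ f → w ∈ D) →
    lin φ f ≡ lin (λ w → coeff f w ℤ.* φ w) (indicator D)
  lin-via-coeff φ f {D} D! f⊆D = begin
    lin φ f
      ≡⟨ lin-cong-∈ f (λ cw∈f → sym (lin-indicator-δ φ D! (f⊆D cw∈f))) ⟩
    lin (λ u → lin (λ w → δ u w ℤ.* φ w) (indicator D)) f
      ≡⟨ lin-swap (λ u w → δ u w ℤ.* φ w) f (indicator D) ⟩
    lin (λ w → lin (λ u → δ u w ℤ.* φ w) f) (indicator D)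
      ≡⟨ lin-cong (indicator D) (λ w → lin-*ʳ (λ u → δ u w) (φ w) f) ⟩
    lin (λ w → lin (λ u → δ u w) f ℤ.* φ w) (indicator D)
      ≡⟨ lin-cong (indicator D) (λ w → cong (ℤ._* φ w) (sym (coeff-lin f w))) ⟩
    lin (λ w → coeff f w ℤ.* φ w) (indicator D) ∎

  lin-resp-coeff : ∀ φ (f g : U N) → (∀ w → coeff f w ≡ coeff g w) → lin φ f ≡ lin φ g
  lin-resp-coeff φ f g f≗g = begin
    lin φ f                                      ≡⟨ lin-via-coeff φ f D! f⊆D ⟩
    lin (λ w → coeff f w ℤ.* φ w) (indicator D)  ≡⟨ lin-cong (indicator D) (λ w → cong (ℤ._* φ w) (f≗g w)) ⟩
    lin (λ w → coeff g w ℤ.* φ w) (indicator D)  ≡⟨ lin-via-coeff φ g D! g⊆D ⟨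
    lin φ g                                      ∎
    where
    D  = deduplicate _≟ᵂ_ (map proj₂ f ++ map proj₂ g)
    D! = deduplicate-! _≟ᵂ_ (map proj₂ f ++ map proj₂ g)
    f⊆D : ∀ {c w} → (c , w) ∈ f → w ∈ D
    f⊆D p = ∈-deduplicate⁺ _≟ᵂ_ (∈-++⁺ˡ (∈-map⁺ proj₂ p))
    g⊆D : ∀ {c w} → (c , w) ∈ g → w ∈ D
    g⊆D p = ∈-deduplicate⁺ _≟ᵂ_ (∈-++⁺ʳ (map proj₂ f) (∈-map⁺ proj₂ p))

  Annihilates : (Word N → ℤ) → U N → Set
  Annihilates χ f = ∀ u v → lin (λ w → χ (u ++ w ++ v)) f ≡ + 0

  annihilates-ideal : ∀ χ → (∀ {g} → KronGen g → Annihilates χ g) →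
    ∀ {f} → InIkron f → Annihilates χ f
  annihilates-ideal χ gens (gen g)   u v = gens g u v
  annihilates-ideal χ gens nil       u v = refl
  annihilates-ideal χ gens (add {f} {g} f∈I g∈I) u v =
    ≡.trans (lin-++ _ f g)
            (cong₂ ℤ._+_ (annihilates-ideal χ gens f∈I u v) (annihilates-ideal χ gens g∈I u v))
  annihilates-ideal χ gens (mulˡ {f} a f∈I) u v =
    ≡.trans (lin-⊛ _ a f) (lin-zero a λ s →
      ≡.trans (lin-cong f (λ t → cong χ (reassoc s t)))
              (annihilates-ideal χ gens f∈I (u ++ s) v))
    where
    reassoc : ∀ s t → u ++ (s ++ t) ++ v ≡ (u ++ s) ++ t ++ v
    reassoc s t = ≡.trans (cong (u ++_) (++-assoc s t v)) (sym (++-assoc u s (t ++ v)))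
  annihilates-ideal χ gens (mulʳ {f} f∈I a) u v =
    ≡.trans (lin-⊛ _ f a) (≡.trans (lin-swap (λ s t → χ (u ++ (s ++ t) ++ v)) f a) (lin-zero a λ t →
      ≡.trans (lin-cong f (λ s → cong (λ z → χ (u ++ z)) (++-assoc s t v)))
              (annihilates-ideal χ gens f∈I u (t ++ v))))
  annihilates-ideal χ gens (resp {f} {g} f≗g f∈I) u v =
    ≡.trans (sym (lin-resp-coeff _ f g f≗g)) (annihilates-ideal χ gens f∈I u v)

  perp-from-generators : ∀ (γ : U N) → (∀ {g} → KronGen g → Annihilates (coeff γ) g) → InIkronPerp γ
  perp-from-generators γ gens f f∈I = begin
    ⟨ f , γ ⟩                            ≡⟨ ⟨,⟩-lin f γ ⟩
    lin (coeff γ) f                      ≡⟨ lin-cong f (λ w → cong (coeff γ) (sym (++-identityʳ w))) ⟩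
    lin (λ w → coeff γ ([] ++ w ++ [])) f ≡⟨ annihilates-ideal (coeff γ) gens f∈I [] [] ⟩
    + 0                                  ∎

-- Ballot sequences

count-≡ : ∀ i s → count i (i ∷ s) ≡ suc (count i s)
count-≡ i s with i ℕ.≟ i
... | yes _   = refl
... | no  i≢i = ⊥-elim (i≢i refl)

count-≢ : ∀ {i x} s → i ≢ x → count i (x ∷ s) ≡ count i s
count-≢ {i} {x} s i≢x with i ℕ.≟ x
... | yes i≡x = ⊥-elim (i≢x i≡x)
... | no  _   = refl

count-≤-∷ : ∀ i x s → count i s ≤ count i (x ∷ s)
count-≤-∷ i x s with i ℕ.≟ x
... | yes _ = n≤1+n _
... | no  _ = ≤-refl

count-∷ : ∀ i x s → count i (x ∷ s) ≡ count i (x ∷ []) + count i s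
count-∷ i x s with i ℕ.≟ x
... | yes _ = refl
... | no  _ = refl

count-↭ : ∀ i {s t} → s ↭ t → count i s ≡ count i t
count-↭ i refl = refl
count-↭ i {x ∷ s} {x ∷ t} (prep x s↭t) = begin
  count i (x ∷ s)                ≡⟨ count-∷ i x s ⟩
  count i (x ∷ []) + count i s   ≡⟨ cong (_+_ (count i (x ∷ []))) (count-↭ i s↭t) ⟩
  count i (x ∷ []) + count i t   ≡⟨ count-∷ i x t ⟨
  count i (x ∷ t)                ∎
count-↭ i {x ∷ y ∷ s} {y ∷ x ∷ t} (swap x y s↭t) = begin
  count i (x ∷ y ∷ s)                          ≡⟨ ≡.trans (count-∷ i x _) (cong (_+_ cx) (count-∷ i y s)) ⟩
  cx + (cy + count i s)                        ≡⟨ cong (λ n → cx + (cy + n)) (count-↭ i s↭t) ⟩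
  cx + (cy + count i t)                        ≡⟨ +-assoc cx cy _ ⟨
  (cx + cy) + count i t                        ≡⟨ cong (_+ count i t) (+-comm cx cy) ⟩
  (cy + cx) + count i t                        ≡⟨ +-assoc cy cx _ ⟩
  cy + (cx + count i t)                        ≡⟨ ≡.trans (count-∷ i y _) (cong (_+_ cy) (count-∷ i x t)) ⟨
  count i (y ∷ x ∷ t)                          ∎
  where
  cx = count i (x ∷ [])
  cy = count i (y ∷ [])
count-↭ i (trans s↭t t↭u) = ≡.trans (count-↭ i s↭t) (count-↭ i t↭u)

-- A record rather than a synonym for the inequality, so that i and s are inferable.
record Ballot (i : ℕ) (s : List ℕ) : Set where
  constructor ballot
  field count-≤ : count (suc i) s ≤ count i s

Ballots : List ℕ → Set
Ballots s = ∀ i → 1 ≤ i → Ballot i s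

Lattice : List ℕ → Set
Lattice []      = ⊤
Lattice (x ∷ s) = Ballots (x ∷ s) × Lattice s

ballot-↭ : ∀ {i s t} → s ↭ t → Ballot i s → Ballot i t
ballot-↭ {i} s↭t (ballot b) = ballot (subst₂ _≤_ (count-↭ (suc i) s↭t) (count-↭ i s↭t) b)

ballots-↭ : ∀ {s t} → s ↭ t → Ballots s → Ballots t
ballots-↭ s↭t b i i≥1 = ballot-↭ s↭t (b i i≥1)

ballot-∷ : ∀ {i x s} → suc i ≢ x → Ballot i s → Ballot i (x ∷ s)
ballot-∷ {i} {x} {s} i+1≢x (ballot b) =
  ballot (≤-trans (≤-reflexive (count-≢ s i+1≢x)) (≤-trans b (count-≤-∷ i x s)))

ballot-∷⁻ : ∀ {i x s} → i ≢ x → Ballot i (x ∷ s) → Ballot i s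
ballot-∷⁻ {i} {x} {s} i≢x (ballot b) =
  ballot (≤-trans (count-≤-∷ (suc i) x s) (≤-trans b (≤-reflexive (count-≢ s i≢x))))

count-pair-suc : ∀ i s → count (suc i) (suc i ∷ i ∷ s) ≡ suc (count (suc i) s)
count-pair-suc i s = ≡.trans (count-≡ (suc i) (i ∷ s)) (cong suc (count-≢ s (1+n≢n {i})))

count-pair : ∀ i s → count i (suc i ∷ i ∷ s) ≡ suc (count i s)
count-pair i s = ≡.trans (count-≢ (i ∷ s) (≢-sym (1+n≢n {i}))) (count-≡ i s)

ballot-pair⁺ : ∀ {i s} → Ballot i s → Ballot i (suc i ∷ i ∷ s)
ballot-pair⁺ {i} {s} (ballot b) =
  ballot (subst₂ _≤_ (sym (count-pair-suc i s)) (sym (count-pair i s)) (s≤s b))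

ballot-pair⁻ : ∀ {i s} → Ballot i (suc i ∷ i ∷ s) → Ballot i s
ballot-pair⁻ {i} {s} (ballot b) = ballot (s≤s⁻¹ (subst₂ _≤_ (count-pair-suc i s) (count-pair i s) b))

ballot-∷-skip : ∀ {i a b s} → a ≢ suc b → Ballot i (a ∷ b ∷ s) → Ballot i s → Ballot i (a ∷ s)
ballot-∷-skip {i} {a} a≢b+1 abs bs = case suc i ℕ.≟ a of λ where
  (no  i+1≢a) → ballot-∷ i+1≢a bs
  (yes refl)  → ballot-∷⁻ (λ i≡b → a≢b+1 (cong suc i≡b)) (ballot-↭ (swap _ _ refl) abs)

lattice⇒ballots : ∀ {s} → Lattice s → Ballots s
lattice⇒ballots {[]}    _       _ _ = ballot z≤n
lattice⇒ballots {_ ∷ _} (b , _)     = b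

lattice⇒drop : ∀ v → Lattice v → ∀ k i → 1 ≤ i → count (suc i) (drop k v) ≤ count i (drop k v)
lattice⇒drop []      _       0       _ _   = z≤n
lattice⇒drop []      _       (suc k) _ _   = z≤n
lattice⇒drop (x ∷ v) (b , l) 0       i i≥1 = Ballot.count-≤ (b i i≥1)
lattice⇒drop (x ∷ v) (b , l) (suc k)       = lattice⇒drop v l k

drop⇒lattice : ∀ v → (∀ k i → 1 ≤ i → count (suc i) (drop k v) ≤ count i (drop k v)) → Lattice v
drop⇒lattice []      _ = _
drop⇒lattice (x ∷ v) b = (λ i i≥1 → ballot (b 0 i i≥1)) , drop⇒lattice v (λ k → b (suc k))

lattice-prefix : ∀ P {R R'} → R ↭ R' → (Lattice R → Lattice R') → Lattice (P ++ R) → Lattice (P ++ R')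
lattice-prefix []      _    f l       = f l
lattice-prefix (x ∷ P) R↭R' f (b , l) = ballots-↭ (prep x (++⁺ˡ P R↭R')) b , lattice-prefix P R↭R' f l

<⇒≢suc : ∀ {a b} → a < b → a ≢ suc b
<⇒≢suc a<b = <⇒≢ (m<n⇒m<1+n a<b)

-- Suffixes of P ++ M ++ Q starting inside P only see the letter counts of M, so
-- replacing M by M' needs control over the suffixes starting inside M only.
infix 4 _↝_

record _↝_ (M M' : List ℕ) : Set where
  field
    permutation : M ↭ M'
    lattice     : ∀ Q → Lattice (M ++ Q) → Lattice (M' ++ Q)

open _↝_

↝-refl : ∀ {M} → M ↝ M
permutation ↝-refl     = refl
lattice     ↝-refl _ l = l

yamanouchi-↝ : ∀ {λ' M M'} P Q → M ↝ M' → Yamanouchi λ' (P ++ M ++ Q) → Yamanouchi λ' (P ++ M' ++ Q)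
yamanouchi-↝ P Q M↝M' (content , suffixes) =
  (λ i i≥1 → ≡.trans (sym (count-↭ i (++⁺ˡ P MQ↭M'Q))) (content i i≥1)) ,
  lattice⇒drop _ (lattice-prefix P MQ↭M'Q (lattice M↝M' Q) (drop⇒lattice _ suffixes))
  where
  MQ↭M'Q = ++⁺ʳ Q (permutation M↝M')

bba↝bab : ∀ a b → b ∷ b ∷ a ∷ [] ↝ b ∷ a ∷ b ∷ []
permutation (bba↝bab a b) = prep b (swap b a refl)
lattice (bba↝bab a b) Q (bbaQ , baQ , _ , l) =
  ballots-↭ (prep b (swap b a refl)) bbaQ , ballots-↭ (swap b a refl) baQ , bQ , l
  where
  bQ : Ballots (b ∷ Q)
  bQ i i≥1 = case suc i ℕ.≟ b of λ where
    (no i+1≢b) → ballot-∷ i+1≢b (lattice⇒ballots l i i≥1)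
    (yes refl) → case i ℕ.≟ a of λ where
      (yes refl) → ballot-pair⁻ (ballot-↭ (prep b (swap b a refl)) (bbaQ i i≥1))
      (no i≢a)   → ballot-∷⁻ i≢a (ballot-↭ (swap b a refl) (baQ i i≥1))

bab↝bba : ∀ {a b} → a ≢ suc b → b ∷ a ∷ b ∷ [] ↝ b ∷ b ∷ a ∷ []
permutation (bab↝bba {a} {b} _) = prep b (swap a b refl)
lattice (bab↝bba {a} {b} a≢b+1) Q (babQ , abQ , _ , l) =
  ballots-↭ (prep b (swap a b refl)) babQ , ballots-↭ (swap a b refl) abQ ,
  (λ i i≥1 → ballot-∷-skip a≢b+1 (abQ i i≥1) (lattice⇒ballots l i i≥1)) , l

baa↝aba : ∀ a b → b ∷ a ∷ a ∷ [] ↝ a ∷ b ∷ a ∷ []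
permutation (baa↝aba a b) = swap b a refl
lattice (baa↝aba a b) Q (baaQ , _ , aQ , l) = ballots-↭ (swap b a refl) baaQ , baQ , aQ , l
  where
  baQ : Ballots (b ∷ a ∷ Q)
  baQ i i≥1 = case suc i ℕ.≟ b of λ where
    (no i+1≢b) → ballot-∷ i+1≢b (aQ i i≥1)
    (yes refl) → case i ℕ.≟ a of λ where
      (yes refl) → ballot-pair⁺ (lattice⇒ballots l i i≥1)
      (no i≢a)   → ballot-∷⁻ i≢a (ballot-↭ (swap b a refl) (baaQ i i≥1))

aba↝baa : ∀ {a b} → a ≢ suc b → a ∷ b ∷ a ∷ [] ↝ b ∷ a ∷ a ∷ []
permutation (aba↝baa {a} {b} _) = swap a b refl
lattice (aba↝baa {a} {b} a≢b+1) Q (abaQ , _ , aQ , l) =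
  ballots-↭ (swap a b refl) abaQ ,
  (λ i i≥1 → ballot-∷-skip a≢b+1 (abaQ i i≥1) (aQ i i≥1)) , aQ , l

ab↝ba : ∀ {a b} → a ≢ suc b → a ∷ b ∷ [] ↝ b ∷ a ∷ []
permutation (ab↝ba {a} {b} _) = swap a b refl
lattice (ab↝ba {a} {b} a≢b+1) Q (abQ , _ , l) =
  ballots-↭ (swap a b refl) abQ ,
  (λ i i≥1 → ballot-∷-skip a≢b+1 (abQ i i≥1) (lattice⇒ballots l i i≥1)) , l

infix 4 _⇄_

_⇄_ : List ℕ → List ℕ → Set
M ⇄ M' = M ↝ M' × M' ↝ M

⇄-refl : ∀ {M} → M ⇄ M
⇄-refl = ↝-refl , ↝-refl

⇄-sym : ∀ {M M'} → M ⇄ M' → M' ⇄ M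
⇄-sym (M↝M' , M'↝M) = M'↝M , M↝M'

bba⇄bab : ∀ {a b} → a < b → b ∷ b ∷ a ∷ [] ⇄ b ∷ a ∷ b ∷ []
bba⇄bab a<b = bba↝bab _ _ , bab↝bba (<⇒≢suc a<b)

baa⇄aba : ∀ {a b} → a < b → b ∷ a ∷ a ∷ [] ⇄ a ∷ b ∷ a ∷ []
baa⇄aba a<b = baa↝aba _ _ , aba↝baa (<⇒≢suc a<b)

ab⇄ba : ∀ {a b} → suc (suc a) ≤ b → a ∷ b ∷ [] ⇄ b ∷ a ∷ []
ab⇄ba a+2≤b = ab↝ba (<⇒≢suc (≤-trans (n≤1+n _) a+2≤b)) , ab↝ba (>⇒≢ a+2≤b)

-- Colored words

++-assoc₄ : ∀ {A : Set} (a b c d e : List A) → a ++ b ++ c ++ d ++ e ≡ (a ++ b ++ c ++ d) ++ e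
++-assoc₄ a b c d e = begin
  a ++ b ++ c ++ d ++ e      ≡⟨ cong (λ z → a ++ b ++ z) (++-assoc c d e) ⟨
  a ++ b ++ (c ++ d) ++ e    ≡⟨ cong (a ++_) (++-assoc b (c ++ d) e) ⟨
  a ++ (b ++ c ++ d) ++ e    ≡⟨ ++-assoc a (b ++ c ++ d) e ⟨
  (a ++ b ++ c ++ d) ++ e    ∎

module _ {N : ℕ} where

  unbarredPart barredPart : Word N → List ℕ
  unbarredPart w = map val (filter (λ x → T? (isUnbarredᵇ x)) w)
  barredPart   w = map val (filter (λ x → T? (isBarredᵇ x)) w)

  unbarredPart-++ : ∀ u v → unbarredPart (u ++ v) ≡ unbarredPart u ++ unbarredPart v
  unbarredPart-++ u v = ≡.trans (cong (map val) (filter-++ _ u v)) (map-++ val (filter _ u) _)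

  barredPart-++ : ∀ u v → barredPart (u ++ v) ≡ barredPart u ++ barredPart v
  barredPart-++ u v = ≡.trans (cong (map val) (filter-++ _ u v)) (map-++ val (filter _ u) _)

  numBarred≡length : ∀ w → numBarred w ≡ length (barredPart w)
  numBarred≡length w = sym (length-map val (filter (λ x → T? (isBarredᵇ x)) w))

  ʳ-infix : ∀ u A v → (u ++ A ++ v) ʳ ≡
    unbarredPart u ++ unbarredPart A ++ unbarredPart v ++
    reverse (barredPart v) ++ reverse (barredPart A) ++ reverse (barredPart u)
  ʳ-infix u A v = begin
    unbarredPart (u ++ A ++ v) ++ reverse (barredPart (u ++ A ++ v))
      ≡⟨ cong₂ _++_ (≡.trans (unbarredPart-++ u _) (cong (Uu ++_) (unbarredPart-++ A v)))
                    (cong reverse (≡.trans (barredPart-++ u _) (cong (Bu ++_) (barredPart-++ A v)))) ⟩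
    (Uu ++ UA ++ Uv) ++ reverse (Bu ++ BA ++ Bv)
      ≡⟨ cong ((Uu ++ UA ++ Uv) ++_)
              (≡.trans (reverse-++ Bu _) (cong (_++ reverse Bu) (reverse-++ BA Bv))) ⟩
    (Uu ++ UA ++ Uv) ++ (reverse Bv ++ reverse BA) ++ reverse Bu
      ≡⟨ ≡.trans (++-assoc Uu _ _) (cong (Uu ++_) (++-assoc UA _ _)) ⟩
    Uu ++ UA ++ Uv ++ (reverse Bv ++ reverse BA) ++ reverse Bu
      ≡⟨ cong (λ z → Uu ++ UA ++ Uv ++ z) (++-assoc (reverse Bv) _ _) ⟩
    Uu ++ UA ++ Uv ++ reverse Bv ++ reverse BA ++ reverse Bu ∎
    where
    Uu = unbarredPart u; UA = unbarredPart A; Uv = unbarredPart v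
    Bu = barredPart u; BA = barredPart A; Bv = barredPart v

  ʳ-infix-barred : ∀ u A v → (u ++ A ++ v) ʳ ≡
    (unbarredPart u ++ unbarredPart A ++ unbarredPart v ++ reverse (barredPart v)) ++
    reverse (barredPart A) ++ reverse (barredPart u)
  ʳ-infix-barred u A v = ≡.trans (ʳ-infix u A v)
    (++-assoc₄ (unbarredPart u) (unbarredPart A) (unbarredPart v) (reverse (barredPart v)) _)

  numBarred-infix : ∀ u {A B} v → barredPart A ↭ barredPart B →
    numBarred (u ++ A ++ v) ≡ numBarred (u ++ B ++ v)
  numBarred-infix u {A} {B} v BA↭BB = begin
    numBarred (u ++ A ++ v)                       ≡⟨ numBarred≡length (u ++ A ++ v) ⟩
    length (barredPart (u ++ A ++ v))             ≡⟨ cong length (split A) ⟩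
    length (barredPart u ++ barredPart A ++ barredPart v)
      ≡⟨ ↭-length (++⁺ˡ (barredPart u) (++⁺ʳ (barredPart v) BA↭BB)) ⟩
    length (barredPart u ++ barredPart B ++ barredPart v) ≡⟨ cong length (split B) ⟨
    length (barredPart (u ++ B ++ v))             ≡⟨ numBarred≡length (u ++ B ++ v) ⟨
    numBarred (u ++ B ++ v)                       ∎
    where
    split : ∀ A → barredPart (u ++ A ++ v) ≡ barredPart u ++ barredPart A ++ barredPart v
    split A = ≡.trans (barredPart-++ u _) (cong (barredPart u ++_) (barredPart-++ A v))

  infix 4 _⇝_

  data _⇝_ (A B : Word N) : Set where
    unbarred : barredPart A ≡ barredPart B → unbarredPart A ↝ unbarredPart B → A ⇝ B
    barred   : unbarredPart A ≡ unbarredPart B →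
               reverse (barredPart A) ↝ reverse (barredPart B) → A ⇝ B

  cyw-⇝ : ∀ {λ' d A B} u v → A ⇝ B → CYW λ' d (u ++ A ++ v) → CYW λ' d (u ++ B ++ v)
  cyw-⇝ {λ'} {A = A} {B} u v (unbarred BA≡BB UA↝UB) (#barred , yamA) =
    ≡.trans (sym (numBarred-infix u v (↭-reflexive BA≡BB))) #barred , yamB
    where
    yamB : Yamanouchi λ' ((u ++ B ++ v) ʳ)
    yamB rewrite ʳ-infix u B v | sym BA≡BB =
      yamanouchi-↝ {λ'} (unbarredPart u) _ UA↝UB (subst (Yamanouchi λ') (ʳ-infix u A v) yamA)
  cyw-⇝ {λ'} {A = A} {B} u v (barred UA≡UB rBA↝rBB) (#barred , yamA) =
    ≡.trans (sym (numBarred-infix u v BA↭BB)) #barred , yamB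
    where
    BA↭BB : barredPart A ↭ barredPart B
    BA↭BB = ↭-trans (↭-sym (↭-reverse (barredPart A)))
                    (↭-trans (permutation rBA↝rBB) (↭-reverse (barredPart B)))
    P = unbarredPart u ++ unbarredPart A ++ unbarredPart v ++ reverse (barredPart v)
    yamB : Yamanouchi λ' ((u ++ B ++ v) ʳ)
    yamB rewrite ʳ-infix-barred u B v | sym UA≡UB =
      yamanouchi-↝ {λ'} P _ rBA↝rBB (subst (Yamanouchi λ') (ʳ-infix-barred u A v) yamA)

  infix 4 _≋_

  _≋_ : Word N → Word N → Set
  A ≋ B = A ⇝ B × B ⇝ A

  unbarred≋ : ∀ {A B} → barredPart A ≡ barredPart B → unbarredPart A ⇄ unbarredPart B → A ≋ B
  unbarred≋ BA≡BB (UA↝UB , UB↝UA) = unbarred BA≡BB UA↝UB , unbarred (sym BA≡BB) UB↝UA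

  barred≋ : ∀ {A B} → unbarredPart A ≡ unbarredPart B →
            reverse (barredPart A) ⇄ reverse (barredPart B) → A ≋ B
  barred≋ UA≡UB (rBA↝rBB , rBB↝rBA) = barred UA≡UB rBA↝rBB , barred (sym UA≡UB) rBB↝rBA

  parts⇒≋ : ∀ {A B} → unbarredPart A ≡ unbarredPart B → barredPart A ≡ barredPart B → A ≋ B
  parts⇒≋ {A} UA≡UB BA≡BB = unbarred≋ BA≡BB (subst (unbarredPart A ⇄_) UA≡UB ⇄-refl)

  yyx≋yxy : ∀ x y → IsUnbarred y → x <ᴸ y → y ∷ y ∷ x ∷ [] ≋ y ∷ x ∷ y ∷ []
  yyx≋yxy (_ , true)  (_ , false) refl _            = parts⇒≋ refl refl
  yyx≋yxy (_ , false) (_ , false) refl (inj₁ i<j)   = unbarred≋ refl (bba⇄bab (s≤s i<j))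
  yyx≋yxy (_ , false) (_ , false) refl (inj₂ (_ , _ , ()))

  zyy≋yzy : ∀ y z → IsUnbarred y → y <ᴸ z → z ∷ y ∷ y ∷ [] ≋ y ∷ z ∷ y ∷ []
  zyy≋yzy (_ , false) (_ , true)  refl _            = parts⇒≋ refl refl
  zyy≋yzy (_ , false) (_ , false) refl (inj₁ j<k)   = unbarred≋ refl (baa⇄aba (s≤s j<k))
  zyy≋yzy (_ , false) (_ , false) refl (inj₂ (_ , _ , ()))

  yyz≋yzy : ∀ y z → IsBarred y → y <ᴸ z → y ∷ y ∷ z ∷ [] ≋ y ∷ z ∷ y ∷ []
  yyz≋yzy (_ , true) (_ , false) refl _             = parts⇒≋ refl refl
  yyz≋yzy (_ , true) (_ , true)  refl (inj₁ j<k)    = barred≋ refl (baa⇄aba (s≤s j<k))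
  yyz≋yzy (_ , true) (_ , true)  refl (inj₂ (_ , () , _))

  xyy≋yxy : ∀ x y → IsBarred y → x <ᴸ y → x ∷ y ∷ y ∷ [] ≋ y ∷ x ∷ y ∷ []
  xyy≋yxy (_ , false) (_ , true) refl _             = parts⇒≋ refl refl
  xyy≋yxy (_ , true)  (_ , true) refl (inj₁ i<j)    = barred≋ refl (bba⇄bab (s≤s i<j))
  xyy≋yxy (_ , true)  (_ , true) refl (inj₂ (_ , () , _))

  down-flips-bar : ∀ {x y : Letter N} → Down y x → isBarredᵇ y ≡ not (isBarredᵇ x)
  down-flips-bar (inj₁ (refl , refl , _)) = refl
  down-flips-bar (inj₂ (refl , refl , _)) = refl

  down²-keeps-bar : ∀ {x w z : Letter N} → Down z w → Down w x → isBarredᵇ z ≡ isBarredᵇ x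
  down²-keeps-bar z⇓w w⇓x =
    ≡.trans (down-flips-bar z⇓w) (≡.trans (cong not (down-flips-bar w⇓x)) (not-involutive _))

  -- Both sides of each pair have the same unbarred and the same barred part.
  xzy≋yxz : ∀ x y z → isBarredᵇ y ≡ not (isBarredᵇ x) → isBarredᵇ z ≡ isBarredᵇ x →
    (x ∷ z ∷ y ∷ [] ≋ y ∷ x ∷ z ∷ []) × (z ∷ x ∷ y ∷ [] ≋ y ∷ z ∷ x ∷ [])
  xzy≋yxz (_ , false) (_ , _) (_ , _) refl refl = parts⇒≋ refl refl , parts⇒≋ refl refl
  xzy≋yxz (_ , true)  (_ , _) (_ , _) refl refl = parts⇒≋ refl refl , parts⇒≋ refl refl

  xz≋zx : ∀ x z → ∃[ w ] ∃[ v ] (Down z w × Down w v × x <ᴸ v) → x ∷ z ∷ [] ≋ z ∷ x ∷ []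
  xz≋zx (_ , false) (_ , true) _ = parts⇒≋ refl refl
  xz≋zx (_ , true) (_ , false) _ = parts⇒≋ refl refl
  -- otherwise x and z carry the same bar and their values differ by at least 2
  xz≋zx (ix , true) (iz , true)
        (_ , _ , inj₁ (refl , refl , refl) , inj₂ (refl , refl , iv+1≡iz) , inj₁ ix<iv) =
    barred≋ refl (⇄-sym (ab⇄ba (s≤s (subst (suc (suc (toℕ ix)) ≤_) iv+1≡iz (s≤s ix<iv)))))
  xz≋zx (ix , false) (iz , false)
        (_ , _ , inj₂ (refl , refl , iw+1≡iz) , inj₁ (refl , refl , refl) , inj₁ ix<iw) =
    unbarred≋ refl (ab⇄ba (s≤s (subst (suc (suc (toℕ ix)) ≤_) iw+1≡iz (s≤s ix<iw))))

  lin-kronGen : ∀ φ → (∀ {A B} → A ≋ B → φ A ≡ φ B) → ∀ {g} → KronGen g → lin φ g ≡ + 0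
  lin-kronGen φ φ-resp (g1 x y y- x<y) = lin-difference φ _ _ (φ-resp (yyx≋yxy x y y- x<y))
  lin-kronGen φ φ-resp (g2 y z y- y<z) = lin-difference φ _ _ (φ-resp (zyy≋yzy y z y- y<z))
  lin-kronGen φ φ-resp (g3 y z y+ y<z) = lin-difference φ _ _ (φ-resp (yyz≋yzy y z y+ y<z))
  lin-kronGen φ φ-resp (g4 x y y+ x<y) = lin-difference φ _ _ (φ-resp (xyy≋yxy x y y+ x<y))
  lin-kronGen φ φ-resp (g5 x y z y⇓x (_ , z⇓w , w⇓x)) =
    lin-nested-commutator φ x y z (φ-resp (proj₁ pairs)) (φ-resp (proj₂ pairs))
    where pairs = xzy≋yxz x y z (down-flips-bar y⇓x) (down²-keeps-bar z⇓w w⇓x)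
  lin-kronGen φ φ-resp (g6 x z z⇓⇓) = lin-difference φ _ _ (φ-resp (xz≋zx x z z⇓⇓))

proposition4p6 : (N n d : ℕ) (λ' : List ℕ) → IsPartitionOf λ' n → d ≤ n →
    (S : List (Word N)) → Unique S → (∀ w → (w ∈ S) ⇔ CYW λ' d w) →
    InIkronPerp (map (λ w → (+ 1 , w)) S)
proposition4p6 N n d λ' _ _ S S! S⇔CYW =
  perp-from-generators (indicator S) λ g u v →
    lin-kronGen (λ w → coeff (indicator S) (u ++ w ++ v)) (λ (A⇝B , B⇝A) →
      coeff-indicator-resp S! S⇔CYW (cyw-⇝ {λ' = λ'} u v A⇝B) (cyw-⇝ {λ' = λ'} u v B⇝A)) g
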